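{- Let $\mathcal L$ be a pre-reversible combined LTSI, and let $r,s$ be paths with $r\approx s$. Then for every event $e$ of $\mathcal L$, $\sharp(r,e)=\sharp(s,e)$.
   Context: Setting. $\mathrm{Lab}$ is a set of labels and $\overline{\mathrm{Lab}}=\{\overline a: a\in\mathrm{Lab}\}$ a disjoint copy (reverse labels), with $\overline{\overline a}=a$. A combined LTSI $(\mathrm{Proc},\mathrm{Lab},\to,\iota)$ consists of a set $\mathrm{Proc}$ of processes, a set of forward transitions $(P,a,Q)$ with $a\in\mathrm{Lab}$, the set $\to$ of all transitions, consisting of the forward transitions together with, for each forward transition $(P,a,Q)$, the backward transition $(Q,\overline a,P)$, and an irreflexive symmetric relation $\iota$ on transitions. Write $t:P\xrightarrow{\alpha}Q$ for $t=(P,\alpha,Q)$ and $\overline t=(Q,\overline\alpha,P)$. A path is a finite (possibly empty) sequence of consecutive transitions. Axioms. SP: whenever $t:P\xrightarrow{\alpha}Q$, $u:P\xrightarrow{\beta}R$, $t\,\iota\,u$, there are $u':Q\xrightarrow{\beta}S$, $t':R\xrightarrow{\alpha}S$. BTI: distinct backward transitions with the same source are independent. WF: no infinite sequence $P_0,P_1,\dots$ with forward transitions $P_{i+1}\xrightarrow{a_i}P_i$ for all $i$. PCI: if $t:P\xrightarrow{\alpha}Q$, $u:P\xrightarrow{\beta}R$, $u':Q\xrightarrow{\beta}S$, $t':R\xrightarrow{\alpha}S$ and $t\,\iota\,u$, then $u'\,\iota\,\overline t$. The LTSI is pre-reversible if it satisfies SP, BTI, WF and PCI. Causal equivalence $\approx$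 is the smallest equivalence on paths closed under composition with (swap) $tu'\approx ut'$ whenever $t:P\xrightarrow{\alpha}Q$, $u:P\xrightarrow{\beta}R$, $t\,\iota\,u$, $u':Q\xrightarrow{\beta}S$, $t':R\xrightarrow{\alpha}S$; and (cancellation) $t\overline t\approx\varepsilon$, $\overline t t\approx\varepsilon$. Events: $\sim$ is the smallest equivalence relation on transitions such that whenever $t:P\xrightarrow{\alpha}Q$, $u:P\xrightarrow{\beta}R$, $u':Q\xrightarrow{\beta}S$, $t':R\xrightarrow{\alpha}S$ with $t\,\iota\,u$, $\overline u\,\iota\,t'$, $\overline{t'}\,\iota\,\overline{u'}$, $u'\,\iota\,\overline t$, and with $Q\ne R$ if $\alpha,\beta$ are both forward or both reverse labels and $P\ne S$ otherwise, then $t\sim t'$. Events are the $\sim$-classes $[t]$; $\overline{[t]}=[\overline t]$. For a path $r$ and event $e$, $\sharp(r,e)$ is the number of transitions $t$ in $r$ with $[t]=e$ minus the number of transitions $t$ in $r$ with $[t]=\overline e$. -}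

module Defs where

open import Data.Nat using (ℕ; suc)
open import Data.Integer using (ℤ; +_; _+_; _-_)
open import Data.Product using (_×_; _,_; Σ; ∃; ∃-syntax)
open import Data.Sum using (_⊎_)
open import Data.List using (List; []; _∷_; _++_)
open import Data.Empty using (⊥)
open import Relation.Nullary using (¬_)
open import Relation.Binary.PropositionalEquality using (_≡_; _≢_)
open import Relation.Binary.Construct.Closure.Equivalence using (EqClosure)

data Dir : Set where
  fw bw : Dir

flipDir : Dir → Dir
flipDir fw = bw
flipDir bw = fw

-- labels in Lab ∪ \overline{Lab}: (fw , a) is a, (bw , a) is ā
Lab± : Set → Set
Lab± Lab = Dir × Lab

bar : ∀ {Lab} → Lab± Lab → Lab± Lab
bar (d , a) = (flipDir d , a)

record Tri (Proc Lab : Set) : Set where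
  constructor tr
  field
    src : Proc
    lab : Lab± Lab
    tgt : Proc
open Tri public

record LTSI : Set₁ where
  field
    Proc : Set
    Lab  : Set
    FT   : Proc → Lab → Proc → Set
    ι     : Tri Proc Lab → Tri Proc Lab → Set
    ι-irr : ∀ t → ¬ ι t t
    ι-sym : ∀ t u → ι t u → ι u t

  Tr : Set
  Tr = Tri Proc Lab

  rev : Tr → Tr
  rev (tr P α Q) = tr Q (bar α) P

  IsTr : Tr → Set
  IsTr (tr P (fw , a) Q) = FT P a Q
  IsTr (tr P (bw , a) Q) = FT Q a P

  -- a square: t : P -α-> Q, u : P -β-> R, u' : Q -β-> S, t' : R -α-> S
  Square : Tr → Tr → Tr → Tr → Set
  Square t u u' t' =
    IsTr t × IsTr u × IsTr u' × IsTr t' ×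
    src u ≡ src t × src u' ≡ tgt t × src t' ≡ tgt u × tgt t' ≡ tgt u' ×
    lab u' ≡ lab u × lab t' ≡ lab t

  SP : Set
  SP = ∀ t u → IsTr t → IsTr u → src t ≡ src u → ι t u →
       ∃[ u' ] ∃[ t' ] Square t u u' t'

  BTI : Set
  BTI = ∀ t u → IsTr t → IsTr u → (∃[ a ] lab t ≡ (bw , a)) → (∃[ b ] lab u ≡ (bw , b)) →
        src t ≡ src u → t ≢ u → ι t u

  WF : Set
  WF = ¬ (Σ (ℕ → Proc) λ P → Σ (ℕ → Lab) λ a → ∀ i → FT (P (suc i)) (a i) (P i))

  PCI : Set
  PCI = ∀ t u u' t' → Square t u u' t' → ι t u → ι u' (rev t)

  PreReversible : Set
  PreReversible = SP × BTI × WF × PCI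

  data IsPath : List Tr → Set where
    []  : IsPath []
    [_] : ∀ {t} → IsTr t → IsPath (t ∷ [])
    _∷_ : ∀ {t u r} → IsTr t → tgt t ≡ src u → IsPath (u ∷ r) → IsPath (t ∷ u ∷ r)

  data Base : List Tr → List Tr → Set where
    swap   : ∀ t u u' t' → Square t u u' t' → ι t u →
             Base (t ∷ u' ∷ []) (u ∷ t' ∷ [])
    cancel : ∀ t → IsTr t → Base (t ∷ rev t ∷ []) []

  data Step : List Tr → List Tr → Set where
    step : ∀ x A B y → Base A B →
           IsPath (x ++ A ++ y) → IsPath (x ++ B ++ y) →
           Step (x ++ A ++ y) (x ++ B ++ y)

  _≈_ : List Tr → List Tr → Set
  _≈_ = EqClosure Step

  proj-dir : Lab± Lab → Dir
  proj-dir (d , _) = d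

  -- generating instances of ∼ (P = src t, Q = tgt t, R = tgt u, S = tgt t')
  data Gen∼ : Tr → Tr → Set where
    gen : ∀ t u u' t' → Square t u u' t' →
          ι t u → ι (rev u) t' → ι (rev t') (rev u') → ι u' (rev t) →
          (proj-dir (lab t) ≡ proj-dir (lab u) → tgt t ≢ tgt u) →
          (proj-dir (lab t) ≢ proj-dir (lab u) → src t ≢ tgt t') →
          Gen∼ t t'

  _∼_ : Tr → Tr → Set
  _∼_ = EqClosure Gen∼

  -- Count r e n : the path r has ♯(r , [e]) = n, where the event [e] is
  -- represented by the transition e, [t] = [e] iff t ∼ e, and
  -- [t] = \overline{[e]} = [rev e] iff t ∼ rev e.
  data Count (e : Tr) : List Tr → ℤ → Set where
    nil   : Count e [] (+ 0)
    plus  : ∀ {t r n} → t ∼ e → ¬ (t ∼ rev e) → Count e r n → Count e (t ∷ r) (n + + 1)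
    minus : ∀ {t r n} → ¬ (t ∼ e) → t ∼ rev e → Count e r n → Count e (t ∷ r) (n - + 1)
    skip  : ∀ {t r n} → ¬ (t ∼ e) → ¬ (t ∼ rev e) → Count e r n → Count e (t ∷ r) n

-- Each generator of causal equivalence preserves ♯(−, e). A swap of a
-- square t u' ≈ u t' pairs every transition with an equivalent one, since
-- t ∼ t' and u ∼ u' (pre-reversibility supplies exactly the independences and
-- distinctness conditions demanded by the definition of ∼); a cancellation
-- t t̄ contributes +k − k, because t̄ belongs to the reverse of the event of t.
-- As ∼ is not decidable, a path need not have a count, so counts are
-- transported along ≈ under double negation, which is harmless for the
-- decidable conclusion n ≡ m.
module Submission where

open import Defs
open import Data.Integer using (ℤ)
open import Data.List using (List)
open import Relation.Binary.PropositionalEquality using (_≡_)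

open import Data.Integer using (+_; -[1+_]; _+_; _-_; -_; _≟_)
open import Data.Integer.Properties
  using (+-assoc; +-identityʳ; +-inverseˡ; +-commutativeSemigroup)
open import Algebra.Properties.CommutativeSemigroup +-commutativeSemigroup
  using (xy∙z≈xz∙y)
open import Data.Nat using (ℕ; zero; suc)
open import Data.Product using (Σ; ∃; ∃-syntax; _×_; _,_; proj₁; proj₂)
open import Data.List using ([]; _∷_; _++_)
open import Data.Empty using (⊥)
open import Function using (_∘_)
open import Relation.Nullary using (¬_; contradiction)
open import Relation.Nullary.Decidable using (decidable-stable; ¬¬-excluded-middle; yes; no)
open import Relation.Nullary.Negation using (¬¬-map)
open import Relation.Binary.Structures using (IsEquivalence)
open import Relation.Binary.PropositionalEquality
  using (_≢_; refl; sym; trans; cong; cong₂; subst; subst₂; isEquivalence; module ≡-Reasoning)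
import Relation.Binary.Construct.Closure.Equivalence as EqClosure

flipDir-involutive : ∀ d → flipDir (flipDir d) ≡ d
flipDir-involutive fw = refl
flipDir-involutive bw = refl

d≢flipDir-d : ∀ d → d ≢ flipDir d
d≢flipDir-d fw ()
d≢flipDir-d bw ()

≢⇒≡flipDir : ∀ {d d′} → d ≢ d′ → d′ ≡ flipDir d
≢⇒≡flipDir {fw} {fw} d≢d′ = contradiction refl d≢d′
≢⇒≡flipDir {fw} {bw} _    = refl
≢⇒≡flipDir {bw} {fw} _    = refl
≢⇒≡flipDir {bw} {bw} d≢d′ = contradiction refl d≢d′

i-k+k≡i : ∀ i k → i - k + k ≡ i
i-k+k≡i i k = begin
  i + - k + k    ≡⟨ +-assoc i (- k) k ⟩
  i + (- k + k)  ≡⟨ cong (λ j → i + j) (+-inverseˡ k) ⟩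
  i + + 0        ≡⟨ +-identityʳ i ⟩
  i              ∎
  where open ≡-Reasoning

module _ (L : LTSI) where
  open LTSI L

  dir : Tr → Dir
  dir = proj-dir ∘ lab

  rev-involutive : ∀ t → rev (rev t) ≡ t
  rev-involutive (tr P (d , a) Q) = cong (λ d′ → tr P (d′ , a) Q) (flipDir-involutive d)

  IsTr-rev : ∀ t → IsTr t → IsTr (rev t)
  IsTr-rev (tr P (fw , a) Q) t∈→ = t∈→
  IsTr-rev (tr P (bw , a) Q) t∈→ = t∈→

  Square-transpose : ∀ {t u u′ t′} → Square t u u′ t′ → Square u t t′ u′
  Square-transpose (it , iu , iu′ , it′ , u↑t , u′↑t , t′↑u , t′↓u′ , u′∶u , t′∶t) =
    iu , it , it′ , iu′ , sym u↑t , t′↑u , u′↑t , sym t′↓u′ , t′∶t , u′∶u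

  Square-rotate : ∀ {t u u′ t′} → Square t u u′ t′ → Square u′ (rev t) (rev t′) u
  Square-rotate {t} {u} {u′} {t′} (it , iu , iu′ , it′ , u↑t , u′↑t , t′↑u , t′↓u′ , u′∶u , t′∶t) =
    iu′ , IsTr-rev t it , IsTr-rev t′ it′ , iu , sym u′↑t , t′↓u′ , u↑t , sym t′↑u ,
    cong bar t′∶t , sym u′∶u

  Gen∼⇒lab≡ : ∀ {t t′} → Gen∼ t t′ → lab t ≡ lab t′
  Gen∼⇒lab≡ (gen _ _ _ _ (_ , _ , _ , _ , _ , _ , _ , _ , _ , t′∶t) _ _ _ _ _ _) = sym t′∶t

  ∼⇒lab≡ : ∀ {t t′} → t ∼ t′ → lab t ≡ lab t′
  ∼⇒lab≡ = EqClosure.gfold isEquivalence lab Gen∼⇒lab≡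

  ∼⇒≁rev : ∀ {t u} → t ∼ u → ¬ (t ∼ rev u)
  ∼⇒≁rev {u = u} t∼u t∼ū =
    d≢flipDir-d (dir u) (cong proj-dir (trans (sym (∼⇒lab≡ t∼u)) (∼⇒lab≡ t∼ū)))

  ∼-sym : ∀ {t u} → t ∼ u → u ∼ t
  ∼-sym = EqClosure.symmetric Gen∼

  ∼-trans : ∀ {t u v} → t ∼ u → u ∼ v → t ∼ v
  ∼-trans = EqClosure.transitive Gen∼

  data Sign (e t : Tr) : ℤ → Set where
    same      : t ∼ e → Sign e t (+ 1)
    opposite  : t ∼ rev e → Sign e t -[1+ 0 ]
    unrelated : ¬ (t ∼ e) → ¬ (t ∼ rev e) → Sign e t (+ 0)

  ¬¬-Sign : ∀ e t → ¬ ¬ ∃ (Sign e t)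
  ¬¬-Sign e t no-sign = ¬¬-excluded-middle λ
    { (yes t∼e) → no-sign (_ , same t∼e)
    ; (no t≁e)  → ¬¬-excluded-middle λ
        { (yes t∼ē) → no-sign (_ , opposite t∼ē)
        ; (no t≁ē)  → no-sign (_ , unrelated t≁e t≁ē) } }

  Sign-resp-∼ : ∀ {e t t′ k} → t ∼ t′ → Sign e t k → Sign e t′ k
  Sign-resp-∼ t∼t′ (same t∼e)          = same (∼-trans (∼-sym t∼t′) t∼e)
  Sign-resp-∼ t∼t′ (opposite t∼ē)      = opposite (∼-trans (∼-sym t∼t′) t∼ē)
  Sign-resp-∼ t∼t′ (unrelated t≁e t≁ē) =
    unrelated (t≁e ∘ ∼-trans t∼t′) (t≁ē ∘ ∼-trans t∼t′)

  Sign-functional : ∀ {e t k k′} → Sign e t k → Sign e t k′ → k ≡ k′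
  Sign-functional (same _)          (same _)          = refl
  Sign-functional (same t∼e)        (opposite t∼ē)    = contradiction t∼ē (∼⇒≁rev t∼e)
  Sign-functional (same t∼e)        (unrelated t≁e _) = contradiction t∼e t≁e
  Sign-functional (opposite t∼ē)    (same t∼e)        = contradiction t∼ē (∼⇒≁rev t∼e)
  Sign-functional (opposite _)      (opposite _)      = refl
  Sign-functional (opposite t∼ē)    (unrelated _ t≁ē) = contradiction t∼ē t≁ē
  Sign-functional (unrelated t≁e _) (same t∼e)        = contradiction t∼e t≁e
  Sign-functional (unrelated _ t≁ē) (opposite t∼ē)    = contradiction t∼ē t≁ē
  Sign-functional (unrelated _ _)   (unrelated _ _)   = refl

  Count-∷⁺ : ∀ {e t r n k} → Sign e t k → Count e r n → Count e (t ∷ r) (n + k)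
  Count-∷⁺ (same t∼e)          c = plus t∼e (∼⇒≁rev t∼e) c
  Count-∷⁺ (opposite t∼ē)      c = minus (λ t∼e → ∼⇒≁rev t∼e t∼ē) t∼ē c
  Count-∷⁺ (unrelated t≁e t≁ē) c = subst (Count _ _) (sym (+-identityʳ _)) (skip t≁e t≁ē c)

  Count-∷⁻ : ∀ {e t r n} → Count e (t ∷ r) n →
             ∃[ k ] ∃[ n₀ ] Sign e t k × Count e r n₀ × n ≡ n₀ + k
  Count-∷⁻ (plus t∼e _ c)      = _ , _ , same t∼e , c , refl
  Count-∷⁻ (minus _ t∼ē c)     = _ , _ , opposite t∼ē , c , refl
  Count-∷⁻ (skip t≁e t≁ē c)    = _ , _ , unrelated t≁e t≁ē , c , sym (+-identityʳ _)

  Count-functional : ∀ {e r n m} → Count e r n → Count e r m → n ≡ m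
  Count-functional {r = []}    nil nil = refl
  Count-functional {r = _ ∷ _} c   c′
    with Count-∷⁻ c | Count-∷⁻ c′
  ... | _ , _ , sign , c₀ , n≡ | _ , _ , sign′ , c₀′ , m≡ =
    trans n≡ (trans (cong₂ _+_ (Count-functional c₀ c₀′) (Sign-functional sign sign′)) (sym m≡))

  Count-swap : ∀ {e t u u′ t′ y n} → t ∼ t′ → u′ ∼ u →
               Count e (t ∷ u′ ∷ y) n → Count e (u ∷ t′ ∷ y) n
  Count-swap t∼t′ u′∼u c
    with Count-∷⁻ c
  ... | k₁ , _ , sign-t , c₁ , n≡ with Count-∷⁻ c₁
  ... | k₂ , n₂ , sign-u′ , c₂ , n₁≡ =
    subst (Count _ _) (sym (trans n≡ (trans (cong (_+ k₁) n₁≡) (xy∙z≈xz∙y n₂ k₂ k₁))))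
      (Count-∷⁺ (Sign-resp-∼ u′∼u sign-u′) (Count-∷⁺ (Sign-resp-∼ t∼t′ sign-t) c₂))

  ♯-Transfer : Tr → List Tr → List Tr → Set
  ♯-Transfer e r s = ∀ {n} → Count e r n → ¬ ¬ Count e s n

  ♯-Transfer-prefix : ∀ {e w w′} → ♯-Transfer e w w′ → ∀ x → ♯-Transfer e (x ++ w) (x ++ w′)
  ♯-Transfer-prefix w⇛w′ []      c = w⇛w′ c
  ♯-Transfer-prefix w⇛w′ (t ∷ x) c with Count-∷⁻ c
  ... | _ , _ , sign , c₀ , n≡ =
    ¬¬-map (subst (Count _ _) (sym n≡) ∘ Count-∷⁺ sign) (♯-Transfer-prefix w⇛w′ x c₀)

  ♯-Equivalent : Tr → List Tr → List Tr → Set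
  ♯-Equivalent e r s = ♯-Transfer e r s × ♯-Transfer e s r

  ♯-Equivalent-isEquivalence : ∀ e → IsEquivalence (♯-Equivalent e)
  ♯-Equivalent-isEquivalence e = record
    { refl  = (λ c ¬c → ¬c c) , (λ c ¬c → ¬c c)
    ; sym   = λ { (r⇛s , s⇛r) → s⇛r , r⇛s }
    ; trans = λ { (r⇛s , s⇛r) (s⇛t , t⇛s) → compose r⇛s s⇛t , compose t⇛s s⇛r }
    }
    where
      compose : ∀ {r s t} → ♯-Transfer e r s → ♯-Transfer e s t → ♯-Transfer e r t
      compose r⇛s s⇛t c ¬c = r⇛s c (λ c′ → s⇛t c′ ¬c)

  module _ (sp : SP) (bti : BTI) (wf : WF) where

    Parallel : Lab → Lab → Proc → Proc → Set
    Parallel a b Y X = FT Y a X × FT Y b X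

    -- The two reverses X → Y are independent by BTI, and SP closes them into
    -- a square whose far side is again a parallel pair, one step further down.
    Parallel-descend : ∀ {a b X Y} → a ≢ b → Parallel a b Y X → ∃[ Z ] Parallel a b Z Y
    Parallel-descend {a} {b} {X} {Y} a≢b (ya , yb)
      with sp (tr X (bw , a) Y) (tr X (bw , b) Y) ya yb refl
              (bti _ _ ya yb (a , refl) (b , refl) refl (a≢b ∘ cong (proj₂ ∘ lab)))
    ... | tr _ _ Z , tr _ _ _ , _ , _ , zb , za , _ , refl , refl , refl , refl , refl = Z , za , zb

    no-parallel : ∀ {a b X Y} → a ≢ b → ¬ Parallel a b Y X
    no-parallel {a} {b} {X} {Y} a≢b par = wf (proj₁ ∘ chain , (λ _ → a) , proj₁ ∘ proj₂ ∘ proj₂ ∘ chain)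
      where
        chain : ℕ → Σ Proc λ X′ → Σ Proc λ Y′ → Parallel a b Y′ X′
        chain zero    = X , Y , par
        chain (suc i) = let (_ , Y′ , par′) = chain i in Y′ , Parallel-descend a≢b par′

    ι-parallel-absurd : ∀ t u → IsTr t → IsTr u → ι t u →
                        src t ≡ src u → tgt t ≡ tgt u → dir t ≡ dir u → ⊥
    ι-parallel-absurd (tr P (fw , a) Q) (tr _ (_ , b) _) pa pb t∣u refl refl refl =
      no-parallel (λ { refl → ι-irr _ t∣u }) (pa , pb)
    ι-parallel-absurd (tr P (bw , a) Q) (tr _ (_ , b) _) pa pb t∣u refl refl refl =
      no-parallel (λ { refl → ι-irr _ t∣u }) (pa , pb)

    module _ (pci : PCI) where

      square-generates-∼ : ∀ {t u u′ t′} → Square t u u′ t′ → ι t u → Gen∼ t t′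
      square-generates-∼ {t} {u} {u′} {t′}
        sq@(it , iu , iu′ , _ , u↑t , u′↑t , _ , t′↓u′ , u′∶u , _) t∣u =
        gen t u u′ t′ sq t∣u ū∣t′ t̄′∣ū′ u′∣t̄ same-dir opposite-dir
        where
          u′∣t̄ : ι u′ (rev t)
          u′∣t̄ = pci _ _ _ _ sq t∣u
          ū∣t′ : ι (rev u) t′
          ū∣t′ = ι-sym _ _ (pci _ _ _ _ (Square-transpose sq) (ι-sym _ _ t∣u))
          t̄′∣ū′ : ι (rev t′) (rev u′)
          t̄′∣ū′ = pci _ _ _ _ (Square-rotate sq) u′∣t̄

          same-dir : dir t ≡ dir u → tgt t ≢ tgt u
          same-dir d≡ Q≡R = ι-parallel-absurd t u it iu t∣u (sym u↑t) Q≡R d≡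

          opposite-dir : dir t ≢ dir u → src t ≢ tgt t′
          opposite-dir d≢ P≡S = ι-parallel-absurd u′ (rev t) iu′ (IsTr-rev t it) u′∣t̄
            u′↑t (trans (sym t′↓u′) (sym P≡S)) (trans (cong proj-dir u′∶u) (≢⇒≡flipDir d≢))

      -- Reflecting the square of a generator across t gives a square on t̄, t̄′.
      Gen∼-rev : ∀ {t t′} → Gen∼ t t′ → Gen∼ (rev t) (rev t′)
      Gen∼-rev (gen _ _ _ _ sq _ _ _ u′∣t̄ _ _) =
        square-generates-∼ (Square-transpose (Square-rotate sq)) (ι-sym _ _ u′∣t̄)

      ∼-rev : ∀ {t t′} → t ∼ t′ → rev t ∼ rev t′
      ∼-rev = EqClosure.gmap rev Gen∼-rev

      Sign-rev : ∀ {e t k} → Sign e t k → Sign e (rev t) (- k)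
      Sign-rev {e} {t} (same t∼e)          = opposite (∼-rev t∼e)
      Sign-rev {e} {t} (opposite t∼ē)      = same (subst (rev t ∼_) (rev-involutive e) (∼-rev t∼ē))
      Sign-rev {e} {t} (unrelated t≁e t≁ē) = unrelated
        (t≁ē ∘ subst (_∼ rev e) (rev-involutive t) ∘ ∼-rev)
        (t≁e ∘ subst₂ _∼_ (rev-involutive t) (rev-involutive e) ∘ ∼-rev)

      Count-cancel : ∀ {e t y n} → Count e (t ∷ rev t ∷ y) n → Count e y n
      Count-cancel c with Count-∷⁻ c
      ... | k , _ , sign-t , c₁ , n≡ with Count-∷⁻ c₁
      ... | _ , n₂ , sign-t̄ , c₂ , n₁≡ with Sign-functional sign-t̄ (Sign-rev sign-t)
      ... | refl = subst (Count _ _) (sym (trans n≡ (trans (cong (_+ k) n₁≡) (i-k+k≡i n₂ k)))) c₂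

      ¬¬-Count-insert : ∀ {e t y n} → Count e y n → ¬ ¬ Count e (t ∷ rev t ∷ y) n
      ¬¬-Count-insert {e} {t} {n = n} c = ¬¬-map insert (¬¬-Sign e t)
        where
          insert : ∃ (Sign e t) → Count e (t ∷ rev t ∷ _) n
          insert (k , sign) =
            subst (Count _ _) (i-k+k≡i n k) (Count-∷⁺ sign (Count-∷⁺ (Sign-rev sign) c))

      Base⇒♯-Equivalent : ∀ {e A B} y → Base A B → ♯-Equivalent e (A ++ y) (B ++ y)
      Base⇒♯-Equivalent y (swap t u u′ t′ sq t∣u) =
          (λ c ¬c → ¬c (Count-swap t∼t′ (∼-sym u∼u′) c))
        , (λ c ¬c → ¬c (Count-swap u∼u′ (∼-sym t∼t′) c))
        where
          t∼t′ = EqClosure.return (square-generates-∼ sq t∣u)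
          u∼u′ = EqClosure.return (square-generates-∼ (Square-transpose sq) (ι-sym _ _ t∣u))
      Base⇒♯-Equivalent y (cancel t _) = (λ c ¬c → ¬c (Count-cancel c)) , ¬¬-Count-insert

      Step⇒♯-Equivalent : ∀ {e r s} → Step r s → ♯-Equivalent e r s
      Step⇒♯-Equivalent (step x A B y base _ _) =
        let (A⇛B , B⇛A) = Base⇒♯-Equivalent y base
        in ♯-Transfer-prefix A⇛B x , ♯-Transfer-prefix B⇛A x

      ≈⇒♯-Equivalent : ∀ {e r s} → r ≈ s → ♯-Equivalent e r s
      ≈⇒♯-Equivalent {e} = EqClosure.fold (♯-Equivalent-isEquivalence e) Step⇒♯-Equivalent

open LTSI

lemma4p12 : (L : LTSI) → PreReversible L →
    (r s : List (Tr L)) → IsPath L r → IsPath L s → _≈_ L r s →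
    (e : Tr L) → IsTr L e →
    (n m : ℤ) → Count L e r n → Count L e s m → n ≡ m
lemma4p12 L (sp , bti , wf , pci) r s _ _ r≈s e _ n m ♯r ♯s =
  decidable-stable (n ≟ m) λ n≢m →
    proj₁ (≈⇒♯-Equivalent L sp bti wf pci r≈s) ♯r λ ♯s′ →
      n≢m (Count-functional L ♯s′ ♯s)
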